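{- If an Elena of size $n$ is chosen uniformly at random, the expected number of attached paths (i.e. the total number of paths hanging off the rightmost-branch nodes $v_1,\dots,v_{k-1}$) is asymptotic to $\frac{n}{\sqrt5}$ as $n\to\infty$.
   Context: Planted plane trees are rooted trees in which the children of every node are linearly ordered. An Elena is a planted plane tree of the following form: there are nodes $v_1,\dots,v_k$ ($k\ge 1$), with $v_1$ the root, such that for each $i<k$ the node $v_{i+1}$ is the rightmost child of $v_i$, the node $v_k$ is a leaf, and for each $i<k$ every other child of $v_i$ (any number $\ge0$ of them, placed to the left of $v_{i+1}$) is the top node of a path (a chain of $\ge1$ nodes each having at most one child); these chains are the attached paths. Equivalently, Elenas correspond to words of the language $(\mathtt{a}\,\mathtt{p}^*)^*\mathtt{a}$, with $\mathtt{a}$ a rightmost-branch node and $\mathtt{p}$ an attached path, so the number of attached paths is the number of letters $\mathtt{p}$. The size of an Elena is its number of nodes. -}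

module Defs where

open import Data.Nat using (ℕ; zero; suc)
import Data.Nat as ℕ
open import Data.Integer using (+_)
open import Data.List using (List; length; map)
open import Data.Nat.ListAction using (sum)
open import Data.List.Membership.Propositional using (_∈_)
open import Data.List.Relation.Unary.Unique.Propositional using (Unique)
open import Data.Rational using (ℚ; _/_; _+_; _-_; _*_; _<_; 0ℚ; 1ℚ)
open import Data.Product using (_×_)
open import Data.Sum using (_⊎_)
open import Function.Bundles using (_⇔_)
open import Relation.Binary.PropositionalEquality using (_≡_)

-- An Elena is encoded by its word in (a p*)* a.
-- The list has one entry per rightmost-branch node v_1,…,v_{k-1} (top to bottom);
-- the final leaf v_k is implicit. The entry for v_i lists the attached paths
-- hanging off v_i (left to right); an attached path with m+1 nodes is stored as m.
Elena : Set
Elena = List (List ℕ)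

pathNodes : List ℕ → ℕ
pathNodes ps = sum (map suc ps)

size : Elena → ℕ
size e = suc (length e ℕ.+ sum (map pathNodes e))

attachedPaths : Elena → ℕ
attachedPaths e = sum (map length e)

record Enumeration : Set where
  field
    elenas   : ℕ → List Elena
    complete : ∀ n e → (e ∈ elenas n) ⇔ (size e ≡ n)
    unique   : ∀ n → Unique (elenas n)

-- a / b as a rational (with the convention a / 0 = 0)
frac : ℕ → ℕ → ℚ
frac a zero    = 0ℚ
frac a (suc b) = (+ a) / suc b

expectedPaths : Enumeration → ℕ → ℚ
expectedPaths E n = frac (sum (map attachedPaths (elenas n))) (length (elenas n))
  where open Enumeration E

five : ℚ
five = (+ 5) / 1

-- For x ≥ 0:  q < √5·x   is written out over ℚ as  q < 0  or  q² < 5x².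
_<√5·_ : ℚ → ℚ → Set
q <√5· x = (q < 0ℚ) ⊎ (q * q < five * (x * x))

-- For x ≥ 0:  √5·x < q   is written out over ℚ as  0 < q  and  5x² < q².
√5·_<_ : ℚ → ℚ → Set
√5· x < q = (0ℚ < q) × (five * (x * x) < q * q)

-- | √5·x − 1 | < ε   (for x ≥ 0)
√5·_≈1within_ : ℚ → ℚ → Set
√5· x ≈1within ε = ((1ℚ - ε) <√5· x) × (√5· x < (1ℚ + ε))

-- Reading the words (a p*)* a letter by letter splits the Elenas of each weight into explicit
-- lists whose lengths and path totals obey linear recurrences. The Elenas with m + 1 nodes are
-- counted by F(2m − 1), and the total number s of their attached paths satisfies
-- 5s = m·L(2m − 1) − F(2m), where L(2m − 1) = 2F(2m) − F(2m − 1) is a Lucas number.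
-- Since L(2m − 1)² + 4 = 5F(2m − 1)², the mean s / F(2m − 1) is m/√5 + O(1). Squaring avoids
-- the square root: with x the mean divided by the size n, 5x² < 1 ≤ 5x² + 6/n.
module Submission where

open import Defs
open import Data.Nat as ℕ using (ℕ; zero; suc; _+_; _*_; _≤_; _<_; s≤s; z≤n)
open import Data.Nat.Properties
open import Algebra.Properties.CommutativeSemigroup +-commutativeSemigroup using (x∙yz≈y∙xz)
open import Data.Nat.ListAction using (sum)
open import Data.Nat.ListAction.Properties using (sum-++; sum-↭)
open import Data.Nat.Tactic.RingSolver using (solve)
open import Data.Integer as ℤ using (+<+; +≤+)
import Data.Integer.Properties as ℤ
open import Data.Rational as ℚ using (ℚ; mkℚ; 0ℚ; 1ℚ; *<*; toℚᵘ; _-_; -_)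
import Data.Rational.Properties as ℚ
import Data.Rational.Unnormalised as ℚᵘ
import Data.Rational.Unnormalised.Properties as ℚᵘ
open import Data.List using (List; []; _∷_; length; map; _++_)
open import Data.List.Properties using (length-map; length-++; map-∘; map-++)
open import Data.List.Membership.Propositional using (_∈_)
open import Data.List.Membership.Propositional.Properties using (∈-map⁺; ∈-map⁻; ∈-++⁺ˡ; ∈-++⁺ʳ; ∈-++⁻)
open import Data.List.Membership.Propositional.Properties.WithK using (unique∧set⇒bag)
open import Data.List.Relation.Binary.BagAndSetEquality using (∼bag⇒↭)
open import Data.List.Relation.Binary.Disjoint.Propositional using (Disjoint)
open import Data.List.Relation.Binary.Permutation.Propositional using (_↭_)
import Data.List.Relation.Binary.Permutation.Propositional.Properties as ↭
open import Data.List.Relation.Unary.Any using (here)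
import Data.List.Relation.Unary.All as All
open import Data.List.Relation.Unary.Unique.Propositional using (Unique; _∷_; [])
import Data.List.Relation.Unary.Unique.Propositional.Properties as Unique
open import Data.Product using (_×_; _,_; proj₂; map₁; ∃-syntax)
open import Data.Sum using (inj₁; inj₂)
open import Function using (_∘_)
open import Function.Bundles using (_⇔_; mk⇔)
import Function.Properties.Equivalence as ⇔
open import Relation.Binary.PropositionalEquality
open import Relation.Nullary using (yes; no)

private variable A B C : Set

↭-of-same-members : ∀ {xs ys : List A} → Unique xs → Unique ys →
  (∀ {z} → z ∈ xs ⇔ z ∈ ys) → xs ↭ ys
↭-of-same-members u v same = ∼bag⇒↭ (unique∧set⇒bag u v same)

map-disjoint : ∀ {f : A → C} {g : B → C} {xs ys} →
  (∀ x y → f x ≢ g y) → Disjoint (map f xs) (map g ys)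
map-disjoint {f = f} {g} f≢g (v∈fxs , v∈gys) with ∈-map⁻ f v∈fxs | ∈-map⁻ g v∈gys
... | x , _ , refl | y , _ , fx≡gy = f≢g x y fx≡gy

sum-map-suc : ∀ (f : A → ℕ) xs → sum (map (suc ∘ f) xs) ≡ length xs + sum (map f xs)
sum-map-suc f []       = refl
sum-map-suc f (x ∷ xs) =
  cong suc (trans (cong (f x +_) (sum-map-suc f xs)) (x∙yz≈y∙xz (f x) (length xs) _))

sum-map-∘ : ∀ (f : B → ℕ) (g : A → B) xs → sum (map f (map g xs)) ≡ sum (map (f ∘ g) xs)
sum-map-∘ f g xs = cong sum (sym (map-∘ xs))

sum-map-++ : ∀ (f : A → ℕ) xs ys → sum (map f (xs ++ ys)) ≡ sum (map f xs) + sum (map f ys)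
sum-map-++ f xs ys = trans (cong sum (map-++ f xs ys)) (sum-++ (map f xs) (map f ys))

toℚᵘ-frac : ∀ a b → toℚᵘ (frac a (suc b)) ℚᵘ.≃ ℚᵘ.mkℚᵘ (ℤ.+ a) b
toℚᵘ-frac a b = ℚ.toℚᵘ-fromℚᵘ (ℚᵘ.mkℚᵘ (ℤ.+ a) b)

frac-* : ∀ a b c d → frac a (suc b) ℚ.* frac c (suc d) ≡ frac (a * c) (suc b * suc d)
frac-* a b c d = ℚ.toℚᵘ-injective (begin
  toℚᵘ (frac a (suc b) ℚ.* frac c (suc d))             ≈⟨ ℚ.toℚᵘ-homo-* (frac a (suc b)) (frac c (suc d)) ⟩
  toℚᵘ (frac a (suc b)) ℚᵘ.* toℚᵘ (frac c (suc d))     ≈⟨ ℚᵘ.*-cong (toℚᵘ-frac a b) (toℚᵘ-frac c d) ⟩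
  ℚᵘ.mkℚᵘ (ℤ.+ a) b ℚᵘ.* ℚᵘ.mkℚᵘ (ℤ.+ c) d                 ≈⟨ ℚᵘ.≃-reflexive (cong (λ i → ℚᵘ.mkℚᵘ i _) (sym (ℤ.pos-* a c))) ⟩
  ℚᵘ.mkℚᵘ (ℤ.+ (a * c)) _                                ≈⟨ ℚᵘ.≃-sym (toℚᵘ-frac (a * c) _) ⟩
  toℚᵘ (frac (a * c) (suc b * suc d))                  ∎)
  where open ℚᵘ.≃-Reasoning

frac-+ : ∀ a b c d → frac a (suc b) ℚ.+ frac c (suc d) ≡ frac (a * suc d + c * suc b) (suc b * suc d)
frac-+ a b c d = ℚ.toℚᵘ-injective (begin
  toℚᵘ (frac a (suc b) ℚ.+ frac c (suc d))             ≈⟨ ℚ.toℚᵘ-homo-+ (frac a (suc b)) (frac c (suc d)) ⟩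
  toℚᵘ (frac a (suc b)) ℚᵘ.+ toℚᵘ (frac c (suc d))     ≈⟨ ℚᵘ.+-cong (toℚᵘ-frac a b) (toℚᵘ-frac c d) ⟩
  ℚᵘ.mkℚᵘ (ℤ.+ a) b ℚᵘ.+ ℚᵘ.mkℚᵘ (ℤ.+ c) d                 ≈⟨ ℚᵘ.≃-reflexive (cong (λ i → ℚᵘ.mkℚᵘ i _) (sym numerator)) ⟩
  ℚᵘ.mkℚᵘ (ℤ.+ (a * suc d + c * suc b)) _                ≈⟨ ℚᵘ.≃-sym (toℚᵘ-frac _ _) ⟩
  toℚᵘ (frac (a * suc d + c * suc b) (suc b * suc d))  ∎)
  where
  open ℚᵘ.≃-Reasoning
  numerator : ℤ.+ (a * suc d + c * suc b) ≡ ℤ.+ a ℤ.* ℤ.+ suc d ℤ.+ ℤ.+ c ℤ.* ℤ.+ suc b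
  numerator = trans (ℤ.pos-+ (a * suc d) _) (cong₂ ℤ._+_ (ℤ.pos-* a (suc d)) (ℤ.pos-* c (suc b)))

frac-<-frac : ∀ a b c d → a * suc d < c * suc b → frac a (suc b) ℚ.< frac c (suc d)
frac-<-frac a b c d lt = ℚ.toℚᵘ-cancel-< (ℚᵘ.<-respʳ-≃ (ℚᵘ.≃-sym (toℚᵘ-frac c d))
  (ℚᵘ.<-respˡ-≃ (ℚᵘ.≃-sym (toℚᵘ-frac a b))
    (ℚᵘ.*<* (subst₂ ℤ._<_ (ℤ.pos-* a (suc d)) (ℤ.pos-* c (suc b)) (+<+ lt)))))

frac-≤-frac : ∀ a b c d → a * suc d ≤ c * suc b → frac a (suc b) ℚ.≤ frac c (suc d)
frac-≤-frac a b c d le = ℚ.toℚᵘ-cancel-≤ (ℚᵘ.≤-respʳ-≃ (ℚᵘ.≃-sym (toℚᵘ-frac c d))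
  (ℚᵘ.≤-respˡ-≃ (ℚᵘ.≃-sym (toℚᵘ-frac a b))
    (ℚᵘ.*≤* (subst₂ ℤ._≤_ (ℤ.pos-* a (suc d)) (ℤ.pos-* c (suc b)) (+≤+ le)))))

frac-archimedean : ∀ c ε → 0ℚ ℚ.< ε → ∃[ N ] (∀ n → N ≤ n → frac c n ℚ.< ε)
frac-archimedean c ε@(mkℚ (ℤ.+ suc p) q _) _ = suc (c * suc q) , λ where
  (suc n) (s≤s cq≤n) → subst (frac c (suc n) ℚ.<_) (ℚ.↥p/↧p≡p ε) (frac-<-frac c n (suc p) q
    (<-≤-trans (s≤s cq≤n) (m≤n*m (suc n) (suc p))))
frac-archimedean c (mkℚ (ℤ.+ zero) _ _) (*<* (+<+ ()))
frac-archimedean c (mkℚ ℤ.-[1+ _ ] _ _) (*<* ())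

≈1within-of-bounds : ∀ {x r ε} → five ℚ.* (x ℚ.* x) ℚ.< 1ℚ → 1ℚ ℚ.≤ five ℚ.* (x ℚ.* x) ℚ.+ r →
  r ℚ.< ε → 0ℚ ℚ.< ε → √5· x ≈1within ε
≈1within-of-bounds {x} {r} {ε} w<1 1≤w+r r<ε 0<ε =
  lower , (ℚ.<-≤-trans 0<1 1≤1+ε , ℚ.<-≤-trans w<1 1≤[1+ε]²)
  where
  w = five ℚ.* (x ℚ.* x)
  d = 1ℚ - ε
  0<1 : 0ℚ ℚ.< 1ℚ
  0<1 = *<* (+<+ (s≤s z≤n))
  1≤1+ε : 1ℚ ℚ.≤ 1ℚ ℚ.+ ε
  1≤1+ε = subst (ℚ._≤ 1ℚ ℚ.+ ε) (ℚ.+-identityʳ 1ℚ) (ℚ.+-monoʳ-≤ 1ℚ (ℚ.<⇒≤ 0<ε))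
  1≤[1+ε]² : 1ℚ ℚ.≤ (1ℚ ℚ.+ ε) ℚ.* (1ℚ ℚ.+ ε)
  1≤[1+ε]² = ℚ.≤-trans 1≤1+ε (subst (ℚ._≤ (1ℚ ℚ.+ ε) ℚ.* (1ℚ ℚ.+ ε)) (ℚ.*-identityˡ (1ℚ ℚ.+ ε))
    (ℚ.*-monoʳ-≤-nonNeg (1ℚ ℚ.+ ε) {{ℚ.nonNegative (ℚ.≤-trans (ℚ.<⇒≤ 0<1) 1≤1+ε)}} 1≤1+ε))
  d≤1 : d ℚ.≤ 1ℚ
  d≤1 = subst (d ℚ.≤_) (ℚ.+-identityʳ 1ℚ) (ℚ.+-monoʳ-≤ 1ℚ (ℚ.neg-antimono-≤ (ℚ.<⇒≤ 0<ε)))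
  d<1-r : d ℚ.< 1ℚ - r
  d<1-r = ℚ.+-monoʳ-< 1ℚ (ℚ.neg-antimono-< r<ε)
  1-r≤w : 1ℚ - r ℚ.≤ w
  1-r≤w = subst (1ℚ - r ℚ.≤_)
    (trans (ℚ.+-assoc w r (- r)) (trans (cong (λ q → w ℚ.+ q) (ℚ.+-inverseʳ r)) (ℚ.+-identityʳ w)))
    (ℚ.+-monoˡ-≤ (- r) 1≤w+r)
  lower : d <√5· x
  lower with d ℚ.<? 0ℚ
  ... | yes d<0 = inj₁ d<0
  ... | no d≮0 = inj₂ (ℚ.≤-<-trans d²≤d (ℚ.<-≤-trans d<1-r 1-r≤w))
    where
    d²≤d : d ℚ.* d ℚ.≤ d
    d²≤d = subst (d ℚ.* d ℚ.≤_) (ℚ.*-identityʳ d) (ℚ.*-monoˡ-≤-nonNeg d {{ℚ.nonNegative (ℚ.≮⇒≥ d≮0)}} d≤1)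

-- Elenas by weight

weight : Elena → ℕ
weight e = sum (map (suc ∘ pathNodes) e)

size≡suc-weight : ∀ e → size e ≡ suc (weight e)
size≡suc-weight e = cong suc (sym (sum-map-suc pathNodes e))

size≡suc⇔weight≡ : ∀ e m → size e ≡ suc m ⇔ weight e ≡ m
size≡suc⇔weight≡ e m rewrite size≡suc-weight e = mk⇔ suc-injective (cong suc)

-- The top (ps , r) stands for the Elena ps ∷ r, and the open top (x , ps , r) for the top
-- (x ∷ ps , r) whose leftmost path, of x + 1 nodes, may still grow.
Top : Set
Top = List ℕ × Elena

topWeight : Top → ℕ
topWeight (ps , r) = pathNodes ps + weight r

OpenTop : Set
OpenTop = ℕ × Top

fromTop : Top → Elena
fromTop (ps , r) = ps ∷ r

close : OpenTop → Top
close (x , ps , r) = (x ∷ ps , r)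

mutual
  elenasOfWeight : ℕ → List Elena
  elenasOfWeight zero    = [] ∷ []
  elenasOfWeight (suc m) = map fromTop (topsOfWeight m)

  topsOfWeight : ℕ → List Top
  topsOfWeight m = map ([] ,_) (elenasOfWeight m) ++ map close (openTopsOfWeight m)

  openTopsOfWeight : ℕ → List OpenTop
  openTopsOfWeight zero    = []
  openTopsOfWeight (suc m) = map (0 ,_) (topsOfWeight m) ++ map (map₁ suc) (openTopsOfWeight m)

mutual
  elenasOfWeight-sound : ∀ m {e} → e ∈ elenasOfWeight m → weight e ≡ m
  elenasOfWeight-sound zero (here refl) = refl
  elenasOfWeight-sound (suc m) e∈ with ∈-map⁻ fromTop e∈
  ... | t , t∈ , refl = cong suc (topsOfWeight-sound m t∈)

  topsOfWeight-sound : ∀ m {t} → t ∈ topsOfWeight m → topWeight t ≡ m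
  topsOfWeight-sound m t∈ with ∈-++⁻ (map ([] ,_) (elenasOfWeight m)) t∈
  ... | inj₁ t∈ˡ with ∈-map⁻ ([] ,_) t∈ˡ
  ...   | e , e∈ , refl = elenasOfWeight-sound m e∈
  topsOfWeight-sound m t∈ | inj₂ t∈ʳ with ∈-map⁻ close t∈ʳ
  ...   | z , z∈ , refl = openTopsOfWeight-sound m z∈

  openTopsOfWeight-sound : ∀ m {z} → z ∈ openTopsOfWeight m → topWeight (close z) ≡ m
  openTopsOfWeight-sound (suc m) z∈ with ∈-++⁻ (map (0 ,_) (topsOfWeight m)) z∈
  ... | inj₁ z∈ˡ with ∈-map⁻ (0 ,_) z∈ˡ
  ...   | t , t∈ , refl = cong suc (topsOfWeight-sound m t∈)
  openTopsOfWeight-sound (suc m) z∈ | inj₂ z∈ʳ with ∈-map⁻ (map₁ suc) z∈ʳ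
  ...   | z , z∈ , refl = cong suc (openTopsOfWeight-sound m z∈)

mutual
  elenasOfWeight-complete : ∀ e → e ∈ elenasOfWeight (weight e)
  elenasOfWeight-complete []       = here refl
  elenasOfWeight-complete (ps ∷ r) = ∈-map⁺ fromTop (topsOfWeight-complete ps r)

  topsOfWeight-complete : ∀ ps r → (ps , r) ∈ topsOfWeight (topWeight (ps , r))
  topsOfWeight-complete []       r = ∈-++⁺ˡ (∈-map⁺ ([] ,_) (elenasOfWeight-complete r))
  topsOfWeight-complete (x ∷ ps) r = ∈-++⁺ʳ _ (∈-map⁺ close (openTopsOfWeight-complete x ps r))

  openTopsOfWeight-complete : ∀ x ps r → (x , ps , r) ∈ openTopsOfWeight (topWeight (x ∷ ps , r))
  openTopsOfWeight-complete zero    ps r = ∈-++⁺ˡ (∈-map⁺ (0 ,_) (topsOfWeight-complete ps r))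
  openTopsOfWeight-complete (suc x) ps r = ∈-++⁺ʳ _ (∈-map⁺ (map₁ suc) (openTopsOfWeight-complete x ps r))

mutual
  elenasOfWeight-unique : ∀ m → Unique (elenasOfWeight m)
  elenasOfWeight-unique zero    = All.[] ∷ []
  elenasOfWeight-unique (suc m) = Unique.map⁺ (λ { {_ , _} {_ , _} refl → refl }) (topsOfWeight-unique m)

  topsOfWeight-unique : ∀ m → Unique (topsOfWeight m)
  topsOfWeight-unique m = Unique.++⁺
    (Unique.map⁺ (cong proj₂) (elenasOfWeight-unique m))
    (Unique.map⁺ (λ { {_ , _ , _} {_ , _ , _} refl → refl }) (openTopsOfWeight-unique m))
    (map-disjoint λ { _ (_ , _ , _) () })

  openTopsOfWeight-unique : ∀ m → Unique (openTopsOfWeight m)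
  openTopsOfWeight-unique zero    = []
  openTopsOfWeight-unique (suc m) = Unique.++⁺
    (Unique.map⁺ (cong proj₂) (topsOfWeight-unique m))
    (Unique.map⁺ (λ { {_ , _} {_ , _} refl → refl }) (openTopsOfWeight-unique m))
    (map-disjoint λ { _ (_ , _) () })

∈-elenasOfWeight⇔ : ∀ m e → e ∈ elenasOfWeight m ⇔ weight e ≡ m
∈-elenasOfWeight⇔ m e = mk⇔ (elenasOfWeight-sound m)
  (λ { refl → elenasOfWeight-complete e })

elenas↭elenasOfWeight : (E : Enumeration) → ∀ m → Enumeration.elenas E (suc m) ↭ elenasOfWeight m
elenas↭elenasOfWeight E m = ↭-of-same-members (unique (suc m)) (elenasOfWeight-unique m) λ {e} →
  ⇔.trans (complete (suc m) e) (⇔.trans (size≡suc⇔weight≡ e m) (⇔.sym (∈-elenasOfWeight⇔ m e)))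
  where open Enumeration E

-- Counting

count openCount total openTotal : ℕ → ℕ
count m     = length (elenasOfWeight m)
openCount m = length (openTopsOfWeight m)
total m     = sum (map attachedPaths (elenasOfWeight m))
openTotal m = sum (map (attachedPaths ∘ fromTop ∘ close) (openTopsOfWeight m))

expectedPaths≡ : (E : Enumeration) → ∀ m → expectedPaths E (suc m) ≡ frac (total m) (count m)
expectedPaths≡ E m = cong₂ frac
  (sum-↭ (↭.map⁺ attachedPaths (elenas↭elenasOfWeight E m)))
  (↭.↭-length (elenas↭elenasOfWeight E m))

length-topsOfWeight : ∀ m → length (topsOfWeight m) ≡ count m + openCount m
length-topsOfWeight m = trans (length-++ (map ([] ,_) (elenasOfWeight m)) {map close (openTopsOfWeight m)})
  (cong₂ _+_ (length-map _ (elenasOfWeight m)) (length-map _ (openTopsOfWeight m)))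

total-topsOfWeight : ∀ m → sum (map (attachedPaths ∘ fromTop) (topsOfWeight m)) ≡ total m + openTotal m
total-topsOfWeight m = trans (sum-map-++ _ (map ([] ,_) (elenasOfWeight m)) _)
  (cong₂ _+_ (sum-map-∘ _ _ (elenasOfWeight m)) (sum-map-∘ _ close (openTopsOfWeight m)))

count-suc : ∀ m → count (suc m) ≡ count m + openCount m
count-suc m = trans (length-map _ (topsOfWeight m)) (length-topsOfWeight m)

openCount-suc : ∀ m → openCount (suc m) ≡ count (suc m) + openCount m
openCount-suc m = trans (length-++ (map (0 ,_) (topsOfWeight m)) {map (map₁ suc) (openTopsOfWeight m)})
  (cong₂ _+_ (trans (length-map _ (topsOfWeight m)) (sym (length-map _ (topsOfWeight m))))
             (length-map _ (openTopsOfWeight m)))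

total-suc : ∀ m → total (suc m) ≡ total m + openTotal m
total-suc m = trans (sum-map-∘ _ _ (topsOfWeight m)) (total-topsOfWeight m)

openTotal-suc : ∀ m → openTotal (suc m) ≡ count (suc m) + total (suc m) + openTotal m
openTotal-suc m = begin
  openTotal (suc m)
    ≡⟨ sum-map-++ f (map (0 ,_) (topsOfWeight m)) _ ⟩
  sum (map f (map (0 ,_) (topsOfWeight m))) + sum (map f (map (map₁ suc) (openTopsOfWeight m)))
    ≡⟨ cong₂ _+_ (sum-map-∘ f _ (topsOfWeight m)) (sum-map-∘ f _ (openTopsOfWeight m)) ⟩
  sum (map (suc ∘ attachedPaths ∘ fromTop) (topsOfWeight m)) + openTotal m
    ≡⟨ cong (_+ openTotal m) (sum-map-suc _ (topsOfWeight m)) ⟩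
  length (topsOfWeight m) + sum (map (attachedPaths ∘ fromTop) (topsOfWeight m)) + openTotal m
    ≡⟨ cong (λ k → k + sum (map (attachedPaths ∘ fromTop) (topsOfWeight m)) + openTotal m)
         (sym (length-map fromTop (topsOfWeight m))) ⟩
  count (suc m) + sum (map (attachedPaths ∘ fromTop) (topsOfWeight m)) + openTotal m
    ≡⟨ cong (λ k → count (suc m) + k + openTotal m) (sym (sum-map-∘ _ _ (topsOfWeight m))) ⟩
  count (suc m) + total (suc m) + openTotal m ∎
  where
  open ≡-Reasoning
  f = attachedPaths ∘ fromTop ∘ close

-- Asymptotics

-- At weight m, a = F(2m − 1) and c = F(2m); the first field is Cassini's identity.
record Invariant (m a c s t : ℕ) : Set where
  field
    cassini      : a * a + a * c ≡ c * c + 1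
    total-eq     : 5 * s + c + m * a ≡ 2 * m * c
    openTotal-eq : 5 * t ≡ m * (c + 2 * a) + 2 * c
    m≤c          : m ≤ c

positive-of-cassini : ∀ {a c} → a * a + a * c ≡ c * c + 1 → 1 ≤ a
positive-of-cassini {zero} {c} eq with () ← trans eq (+-comm (c * c) 1)
positive-of-cassini {suc a} _ = s≤s z≤n

invariant-step : ∀ {m a c s t} → Invariant m a c s t →
  Invariant (suc m) (a + c) ((a + c) + c) (s + t) ((a + c) + (s + t) + t)
invariant-step {m} {a} {c} {s} {t} inv = record
  { cassini = +-cancelʳ-≡ (c * c + 1) _ _ (begin
      (a + c) * (a + c) + (a + c) * ((a + c) + c) + (c * c + 1)
        ≡⟨ solve (a ∷ c ∷ []) ⟩
      ((a + c) + c) * ((a + c) + c) + 1 + (a * a + a * c)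
        ≡⟨ cong (λ k → ((a + c) + c) * ((a + c) + c) + 1 + k) cassini ⟩
      ((a + c) + c) * ((a + c) + c) + 1 + (c * c + 1) ∎)
  ; total-eq = +-cancelʳ-≡ (c + m * a) _ _ (begin
      5 * (s + t) + ((a + c) + c) + suc m * (a + c) + (c + m * a)
        ≡⟨ solve (m ∷ a ∷ c ∷ s ∷ t ∷ []) ⟩
      (5 * s + c + m * a) + 5 * t + ((a + c) + c) + suc m * (a + c)
        ≡⟨ cong₂ (λ k l → k + l + ((a + c) + c) + suc m * (a + c)) total-eq openTotal-eq ⟩
      2 * m * c + (m * (c + 2 * a) + 2 * c) + ((a + c) + c) + suc m * (a + c)
        ≡⟨ solve (m ∷ a ∷ c ∷ []) ⟩
      2 * suc m * ((a + c) + c) + (c + m * a) ∎)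
  ; openTotal-eq = +-cancelʳ-≡ (c + m * a) _ _ (begin
      5 * ((a + c) + (s + t) + t) + (c + m * a)
        ≡⟨ solve (m ∷ a ∷ c ∷ s ∷ t ∷ []) ⟩
      (5 * s + c + m * a) + 2 * (5 * t) + 5 * (a + c)
        ≡⟨ cong₂ (λ k l → k + 2 * l + 5 * (a + c)) total-eq openTotal-eq ⟩
      2 * m * c + 2 * (m * (c + 2 * a) + 2 * c) + 5 * (a + c)
        ≡⟨ solve (m ∷ a ∷ c ∷ []) ⟩
      suc m * (((a + c) + c) + 2 * (a + c)) + 2 * ((a + c) + c) + (c + m * a) ∎)
  ; m≤c = ≤-trans (+-mono-≤ (positive-of-cassini cassini) m≤c) (m≤m+n (a + c) c)
  }
  where
  open Invariant inv
  open ≡-Reasoning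

invariant : ∀ m → Invariant m (count m) (openCount m) (total m) (openTotal m)
invariant zero = record { cassini = refl ; total-eq = refl ; openTotal-eq = refl ; m≤c = z≤n }
invariant (suc m) rewrite openTotal-suc m | openCount-suc m | count-suc m | total-suc m =
  invariant-step (invariant m)

-- With C = A + D and L = A + 2D = 2C − A the invariant says 5S + C = M·L and L² + 4 = 5A²,
-- so (5S + C)² + 4M² = 5(MA)²: up to O(A), 5S is √5·MA.
module Bounds {M A D S T : ℕ} (inv : Invariant M A (A + D) S T) (D≤A : D ≤ A) where
  open Invariant inv
  open ≤-Reasoning

  1≤A : 1 ≤ A
  1≤A = positive-of-cassini cassini

  pell : (A + 2 * D) * (A + 2 * D) + 4 ≡ 5 * (A * A)
  pell = +-cancelʳ-≡ (4 * ((A + D) * (A + D) + 1)) _ _ (begin-equality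
    (A + 2 * D) * (A + 2 * D) + 4 + 4 * ((A + D) * (A + D) + 1)
      ≡⟨ cong (λ k → (A + 2 * D) * (A + 2 * D) + 4 + 4 * k) (sym cassini) ⟩
    (A + 2 * D) * (A + 2 * D) + 4 + 4 * (A * A + A * (A + D))
      ≡⟨ solve (A ∷ D ∷ []) ⟩
    5 * (A * A) + 4 * ((A + D) * (A + D) + 1) ∎)

  total-identity : 5 * S + (A + D) ≡ M * (A + 2 * D)
  total-identity = +-cancelʳ-≡ (M * A) _ _ (trans total-eq (solve (M ∷ A ∷ D ∷ [])))

  scaled-pell : (5 * S + (A + D)) * (5 * S + (A + D)) + 4 * (M * M) ≡ 5 * ((M * A) * (M * A))
  scaled-pell = begin-equality
    (5 * S + (A + D)) * (5 * S + (A + D)) + 4 * (M * M)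
      ≡⟨ cong (λ k → k * k + 4 * (M * M)) total-identity ⟩
    (M * (A + 2 * D)) * (M * (A + 2 * D)) + 4 * (M * M)
      ≡⟨ solve (M ∷ A ∷ D ∷ []) ⟩
    (M * M) * ((A + 2 * D) * (A + 2 * D) + 4)
      ≡⟨ cong ((M * M) *_) pell ⟩
    (M * M) * (5 * (A * A))
      ≡⟨ solve (M ∷ A ∷ []) ⟩
    5 * ((M * A) * (M * A)) ∎

  5S²≤[MA]² : 5 * (S * S) ≤ (M * A) * (M * A)
  5S²≤[MA]² = *-cancelˡ-≤ 5 (begin
    5 * (5 * (S * S))                                   ≡⟨ solve (S ∷ []) ⟩
    (5 * S) * (5 * S)                                   ≤⟨ *-mono-≤ (m≤m+n (5 * S) _) (m≤m+n (5 * S) _) ⟩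
    (5 * S + (A + D)) * (5 * S + (A + D))               ≤⟨ m≤m+n _ (4 * (M * M)) ⟩
    (5 * S + (A + D)) * (5 * S + (A + D)) + 4 * (M * M) ≡⟨ scaled-pell ⟩
    5 * ((M * A) * (M * A))                             ∎)

  total-upper : 5 * (S * S) < (A * suc M) * (A * suc M)
  total-upper = ≤-<-trans 5S²≤[MA]² (*-mono-< MA<A[M+1] MA<A[M+1])
    where
    MA<A[M+1] : M * A < A * suc M
    MA<A[M+1] = subst (M * A <_) (*-comm (suc M) A) (m<n+m (M * A) 1≤A)

  A+D≤2A : A + D ≤ 2 * A
  A+D≤2A = begin A + D ≤⟨ +-monoʳ-≤ A D≤A ⟩ A + A ≡⟨ solve (A ∷ []) ⟩ 2 * A ∎

  A+2D≤3A : A + 2 * D ≤ 3 * A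
  A+2D≤3A = begin A + 2 * D ≤⟨ +-monoʳ-≤ A (*-monoʳ-≤ 2 D≤A) ⟩ A + 2 * A ≡⟨ solve (A ∷ []) ⟩ 3 * A ∎

  cross-term : (5 * S + (A + D)) * (5 * S + (A + D)) ≤ 5 * (5 * (S * S)) + 12 * (M * (A * A))
  cross-term = begin
    (5 * S + (A + D)) * (5 * S + (A + D))
      ≤⟨ m≤m+n _ ((A + D) * (A + D)) ⟩
    (5 * S + (A + D)) * (5 * S + (A + D)) + (A + D) * (A + D)
      ≡⟨ solve (S ∷ A ∷ D ∷ []) ⟩
    5 * (5 * (S * S)) + 2 * (A + D) * (5 * S + (A + D))
      ≡⟨ cong (λ k → 5 * (5 * (S * S)) + 2 * (A + D) * k) total-identity ⟩
    5 * (5 * (S * S)) + 2 * (A + D) * (M * (A + 2 * D))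
      ≤⟨ +-monoʳ-≤ (5 * (5 * (S * S))) (*-mono-≤ (*-monoʳ-≤ 2 A+D≤2A) (*-monoʳ-≤ M A+2D≤3A)) ⟩
    5 * (5 * (S * S)) + 2 * (2 * A) * (M * (3 * A))
      ≡⟨ cong (5 * (5 * (S * S)) +_) (solve (M ∷ A ∷ [])) ⟩
    5 * (5 * (S * S)) + 12 * (M * (A * A)) ∎

  M²≤2MA² : M * M ≤ 2 * (M * (A * A))
  M²≤2MA² = begin
    M * M             ≤⟨ *-monoʳ-≤ M (≤-trans m≤c A+D≤2A) ⟩
    M * (2 * A)       ≤⟨ *-monoʳ-≤ M (*-monoʳ-≤ 2 (≤-trans (≤-reflexive (sym (*-identityʳ A))) (*-monoʳ-≤ A 1≤A))) ⟩
    M * (2 * (A * A)) ≡⟨ solve (M ∷ A ∷ []) ⟩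
    2 * (M * (A * A)) ∎

  total-lower : (A * suc M) * (A * suc M) ≤ 5 * (S * S) + 6 * (suc M * (A * A))
  total-lower = *-cancelˡ-≤ 5 (begin
    5 * ((A * suc M) * (A * suc M))
      ≡⟨ solve (M ∷ A ∷ []) ⟩
    5 * ((M * A) * (M * A)) + 5 * ((2 * M + 1) * (A * A))
      ≡⟨ cong (_+ 5 * ((2 * M + 1) * (A * A))) (sym scaled-pell) ⟩
    (5 * S + (A + D)) * (5 * S + (A + D)) + 4 * (M * M) + 5 * ((2 * M + 1) * (A * A))
      ≤⟨ +-monoˡ-≤ _ (+-mono-≤ cross-term (*-monoʳ-≤ 4 M²≤2MA²)) ⟩
    5 * (5 * (S * S)) + 12 * (M * (A * A)) + 4 * (2 * (M * (A * A))) + 5 * ((2 * M + 1) * (A * A))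
      ≤⟨ m≤m+n _ (25 * (A * A)) ⟩
    5 * (5 * (S * S)) + 12 * (M * (A * A)) + 4 * (2 * (M * (A * A))) + 5 * ((2 * M + 1) * (A * A)) + 25 * (A * A)
      ≡⟨ solve (M ∷ A ∷ S ∷ []) ⟩
    5 * (5 * (S * S) + 6 * (suc M * (A * A))) ∎)

five-x²≡ : ∀ A B M → let x = frac B (suc A) ℚ.* frac 1 (suc M) ; N = suc A * suc M in
  five ℚ.* (x ℚ.* x) ≡ frac (5 * (B * B)) (N * N)
five-x²≡ A B M = begin
  five ℚ.* (x ℚ.* x)
    ≡⟨ cong (λ y → five ℚ.* (y ℚ.* y)) (frac-* B A 1 M) ⟩
  five ℚ.* (frac (B * 1) N ℚ.* frac (B * 1) N)
    ≡⟨ cong (five ℚ.*_) (frac-* (B * 1) (ℕ.pred N) (B * 1) (ℕ.pred N)) ⟩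
  five ℚ.* frac ((B * 1) * (B * 1)) (N * N)
    ≡⟨ frac-* 5 0 ((B * 1) * (B * 1)) (ℕ.pred (N * N)) ⟩
  frac (5 * ((B * 1) * (B * 1))) (1 * (N * N))
    ≡⟨ cong₂ frac (cong (λ b → 5 * (b * b)) (*-identityʳ B)) (*-identityˡ (N * N)) ⟩
  frac (5 * (B * B)) (N * N) ∎
  where
  open ≡-Reasoning
  x = frac B (suc A) ℚ.* frac 1 (suc M)
  N = suc A * suc M

x²-bounds : ∀ {A B M} → 1 ≤ A →
  5 * (B * B) < (A * suc M) * (A * suc M) →
  (A * suc M) * (A * suc M) ≤ 5 * (B * B) + 6 * (suc M * (A * A)) →
  let x = frac B A ℚ.* frac 1 (suc M) in
  five ℚ.* (x ℚ.* x) ℚ.< 1ℚ × 1ℚ ℚ.≤ five ℚ.* (x ℚ.* x) ℚ.+ frac 6 (suc M)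
x²-bounds {suc A} {B} {M} _ upper lower rewrite five-x²≡ A B M = w<1 , 1≤w+6/n
  where
  N = suc A * suc M

  w<1 : frac (5 * (B * B)) (N * N) ℚ.< 1ℚ
  w<1 = frac-<-frac (5 * (B * B)) (ℕ.pred (N * N)) 1 0
    (subst₂ _<_ (sym (*-identityʳ _)) (sym (*-identityˡ _)) upper)

  1≤w+6/n : 1ℚ ℚ.≤ frac (5 * (B * B)) (N * N) ℚ.+ frac 6 (suc M)
  1≤w+6/n rewrite frac-+ (5 * (B * B)) (ℕ.pred (N * N)) 6 M =
    frac-≤-frac 1 0 (5 * (B * B) * suc M + 6 * (N * N)) (ℕ.pred ((N * N) * suc M)) (begin
      1 * ((N * N) * suc M)                                   ≡⟨ *-identityˡ _ ⟩
      (N * N) * suc M                                         ≤⟨ *-monoˡ-≤ (suc M) lower ⟩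
      (5 * (B * B) + 6 * (suc M * (suc A * suc A))) * suc M   ≡⟨ solve (A ∷ B ∷ M ∷ []) ⟩
      (5 * (B * B) * suc M + 6 * ((suc A * suc M) * (suc A * suc M))) * 1 ∎)
    where open ≤-Reasoning

expectation-bounds : ∀ m → let x = frac (total (suc m)) (count (suc m)) ℚ.* frac 1 (suc (suc m)) in
  five ℚ.* (x ℚ.* x) ℚ.< 1ℚ × 1ℚ ℚ.≤ five ℚ.* (x ℚ.* x) ℚ.+ frac 6 (suc (suc m))
expectation-bounds m = x²-bounds 1≤A total-upper total-lower
  where
  inv : Invariant (suc m) (count (suc m)) (count (suc m) + openCount m) (total (suc m)) (openTotal (suc m))
  inv = subst (λ c → Invariant (suc m) (count (suc m)) c (total (suc m)) (openTotal (suc m)))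
    (openCount-suc m) (invariant (suc m))
  open Bounds inv (subst (openCount m ≤_) (sym (count-suc m)) (m≤n+m (openCount m) (count m)))

mainTheorem4 : (E : Enumeration) → (ε : ℚ) → 0ℚ ℚ.< ε →
    ∃[ N ] (∀ (n : ℕ) → N ≤ n →
      √5· (expectedPaths E n ℚ.* frac 1 n) ≈1within ε)
mainTheorem4 E ε 0<ε with frac-archimedean 6 ε 0<ε
... | N , 6/n<ε = 2 + N , λ where
  (suc (suc m)) (s≤s (s≤s N≤m)) →
    let n = suc (suc m)
        w<1 , 1≤w+6/n = expectation-bounds m
    in subst (λ e → √5· (e ℚ.* frac 1 n) ≈1within ε) (sym (expectedPaths≡ E (suc m)))
         (≈1within-of-bounds {x = frac (total (suc m)) (count (suc m)) ℚ.* frac 1 n}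
           w<1 1≤w+6/n (6/n<ε n (m≤n⇒m≤o+n 2 N≤m)) 0<ε)
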